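{- Let $\mathcal{F}$ and $\mathcal{F}'$ be diagonally equivalent Ferrers diagrams in $\mathbb{N}\times\mathbb{N}$. Then $\Pi(\mathcal{F},i,j)$ and $\Pi(\mathcal{F}',i,j)$ are diagonally equivalent for all $i\in\mathbb{N}$ and $j\in\{1,\ldots,|\Delta_i\cap\mathcal{F}|\}$.
   Context: $\mathbb{N}$ denotes the positive integers; a cell $(i,j)$ lies in row $i$, column $j$. A Ferrers diagram is a finite set $\mathcal{F}\subseteq\mathbb{N}\times\mathbb{N}$ such that $(i,j)\in\mathcal{F}$ implies $(s,t)\in\mathcal{F}$ for all $1\le s\le i$, $1\le t\le j$. The $i$-th diagonal is $\Delta_i=\{(s,i-s+1):s\in\{1,\ldots,i\}\}$. Ferrers diagrams $\mathcal{F},\mathcal{F}'$ are diagonally equivalent if $|\Delta_i\cap\mathcal{F}|=|\Delta_i\cap\mathcal{F}'|$ for all $i\in\mathbb{N}$. For $1\le j\le|\Delta_i\cap\mathcal{F}|$, $(\Delta_i\cap\mathcal{F})_j$ denotes the $j$-th element of $\Delta_i\cap\mathcal{F}$ counted from the top-most row; labels $(i,j)$ are compared in the lexicographic order $<_{\mathrm{lex}}$. For $P\subseteq\mathbb{N}\times\mathbb{N}$, $\mathrm{ATK}(P)=\bigcup_{(a,b)\in P}\big(\{(s,b):1\le s\le a\}\cup\{(a,t):1\le t\le b\}\big)$. The reduction $\Pi(\mathcal{F},i,j)$ is the Ferrers diagram obtained from $\mathcal{F}$ by removing $\mathrm{ATK}(\{(\Delta_i\cap\mathcal{F})_j\})\cup\{(\Delta_s\cap\mathcal{F})_t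 : (i,j)<_{\mathrm{lex}}(s,t)\}$ and aligning the remaining cells to the top and then to the left. -}

module Defs where

open import Data.Nat.Base using (ℕ; zero; suc; _+_; _∸_; _≤_; _≤ᵇ_; _<ᵇ_; _≡ᵇ_)
open import Data.Bool.Base using (Bool; true; false; _∧_; _∨_; not; if_then_else_)
open import Data.Product using (_×_)
open import Relation.Binary.PropositionalEquality using (_≡_)

-- A subset of ℕ × ℕ given by its (decidable) membership function:
-- S r c ≡ true  means the cell (r , c) (row r, column c) belongs to S.
-- Cells with a zero coordinate are meant to be absent (ℕ of the paper = positive integers).
Cells : Set
Cells = ℕ → ℕ → Bool

record Ferrers : Set where
  field
    mem        : Cells
    bound      : ℕ
    positive   : ∀ r c → mem r c ≡ true → (1 ≤ r) × (1 ≤ c)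
    finite     : ∀ r c → mem r c ≡ true → (r ≤ bound) × (c ≤ bound)
    downClosed : ∀ r c s t → mem r c ≡ true → 1 ≤ s → s ≤ r → 1 ≤ t → t ≤ c →
                 mem s t ≡ true
open Ferrers public

count : (ℕ → Bool) → ℕ → ℕ
count f zero    = 0
count f (suc n) = count f n + (if f (suc n) then 1 else 0)

anyUpTo : (ℕ → Bool) → ℕ → Bool
anyUpTo f zero    = false
anyUpTo f (suc n) = anyUpTo f n ∨ f (suc n)

-- Δ_i = {(s , i - s + 1) : s ∈ {1,…,i}};  the cell of Δ_i in row s is (s , suc i ∸ s).
onDiag : Cells → ℕ → ℕ → Bool
onDiag S i s = S s (suc i ∸ s)

diagCount : Cells → ℕ → ℕ
diagCount S i = count (onDiag S i) i

-- number of cells of Δ_i ∩ S lying in rows 1,…,a  (the position, counted from the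
-- top-most row, of the cell (a , i - a + 1) of Δ_i ∩ S)
rank : Cells → ℕ → ℕ → ℕ
rank S i a = count (onDiag S i) a

DiagEquiv : Cells → Cells → Set
DiagEquiv S S' = ∀ i → diagCount S i ≡ diagCount S' i

inATK : ℕ → ℕ → ℕ → ℕ → Bool
inATK a b x y = ((y ≡ᵇ b) ∧ (1 ≤ᵇ x) ∧ (x ≤ᵇ a)) ∨ ((x ≡ᵇ a) ∧ (1 ≤ᵇ y) ∧ (y ≤ᵇ b))

-- (x , y) ∈ ATK({(Δ_i ∩ S)_j}): the j-th element of Δ_i ∩ S (from the top) is the
-- unique cell (a , i - a + 1) ∈ S, 1 ≤ a ≤ i, with rank S i a = j.
inATKjth : Cells → ℕ → ℕ → ℕ → ℕ → Bool
inATKjth S i j x y =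
  anyUpTo (λ a → onDiag S i a ∧ (rank S i a ≡ᵇ j) ∧ inATK a (suc i ∸ a) x y) i

-- (x , y) = (Δ_s ∩ S)_t for some (s , t) with (i , j) <lex (s , t):
-- the cell lies in S on diagonal s = x + y - 1 at position t = rank S s x, and
-- either i < s, or s = i and j < t.
isLexLater : Cells → ℕ → ℕ → ℕ → ℕ → Bool
isLexLater S i j x y =
  (1 ≤ᵇ x) ∧ (1 ≤ᵇ y) ∧ S x y ∧
  ((i <ᵇ (x + y ∸ 1)) ∨ (((x + y ∸ 1) ≡ᵇ i) ∧ (j <ᵇ rank S i x)))

remaining : Cells → ℕ → ℕ → Cells
remaining S i j x y = S x y ∧ not (inATKjth S i j x y ∨ isLexLater S i j x y)

-- Align the cells to the top: column c of the result consists of rows 1,…,k where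
-- k is the number of cells of S in column c (rows 1,…,N; N a bound for S).
alignTop : ℕ → Cells → Cells
alignTop N S r c = (1 ≤ᵇ r) ∧ (1 ≤ᵇ c) ∧ (r ≤ᵇ count (λ x → S x c) N)

-- Align the cells to the left: row r of the result consists of columns 1,…,k where
-- k is the number of cells of S in row r (columns 1,…,N; N a bound for S).
alignLeft : ℕ → Cells → Cells
alignLeft N S r c = (1 ≤ᵇ r) ∧ (1 ≤ᵇ c) ∧ (c ≤ᵇ count (λ y → S r y) N)

-- The reduction Π(F, i, j): remove the cells, align to the top, then to the left.
-- The bound of F bounds all coordinates throughout.
Π : Ferrers → ℕ → ℕ → Cells
Π F i j = alignLeft (bound F) (alignTop (bound F) (remaining (mem F) i j))

-- Let (a , b) be the j-th cell of Δᵢ ∩ F and let T ("truncated") consist of the cells of F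
-- on the diagonals before Δᵢ together with the first j cells of Δᵢ.  Inside T the attack set
-- of (a , b) is exactly row a plus column b, and every other removed cell lies outside T; so
-- what remains is T with row a and column b deleted.  As T is a Ferrers diagram, aligning
-- to the top and then to the left just closes up that row and column:
-- Π(F, i, j)(r , c) = T(punchIn a r , punchIn b c).  Hence for M + 1 ≤ i the diagonal
-- Δ_M ∩ Π(F, i, j) is Δ_{M+1} ∩ T without its one cell in row a or column b, and beyond Δᵢ
-- both are empty; so |Δ_M ∩ Π(F, i, j)| is |Δ_{M+1} ∩ F| − 1, j − 1 or 0 according as
-- M + 1 < i, M + 1 = i or M + 1 > i, which depends only on the diagonal counts of F.
module Submission where

open import Defs
open import Data.Nat.Base
open import Data.Nat.Properties
open import Data.Bool.Base using (Bool; true; false; _∧_; _∨_; not; if_then_else_)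
open import Data.Bool.Properties using (¬-not; ∧-zeroʳ; ∧-identityʳ; ∨-identityʳ; ∨-zeroʳ)
open import Data.Product using (_×_; _,_; proj₁; proj₂; ∃-syntax)
open import Data.Sum using (_⊎_; inj₁; inj₂; [_,_]′)
open import Function.Bundles using (_⇔_; mk⇔)
open import Relation.Nullary using (Dec; yes; no; does; contradiction)
open import Relation.Nullary.Decidable using (dec-true; dec-false; does-⇔)
open import Relation.Binary using (tri<; tri≈; tri>)
open import Relation.Binary.PropositionalEquality hiding ([_])
open import Function.Base using (_∘_; id)
open import Algebra.Properties.CommutativeSemigroup +-commutativeSemigroup using (xy∙z≈xz∙y)

private
  variable
    a m n r x y : ℕ
    f g : ℕ → Bool

true⊎false : ∀ b → b ≡ true ⊎ b ≡ false
true⊎false true  = inj₁ refl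
true⊎false false = inj₂ refl

-- These hold by conversion: does (m ≤? n) reduces to m ≤ᵇ n, and likewise for _<?_ and _≟_.
≤ᵇ-true : m ≤ n → (m ≤ᵇ n) ≡ true
≤ᵇ-true {m} {n} = dec-true (m ≤? n)

≤ᵇ-false : m ≰ n → (m ≤ᵇ n) ≡ false
≤ᵇ-false {m} {n} = dec-false (m ≤? n)

<ᵇ-true : m < n → (m <ᵇ n) ≡ true
<ᵇ-true {m} {n} = dec-true (m <? n)

<ᵇ-false : m ≮ n → (m <ᵇ n) ≡ false
<ᵇ-false {m} {n} = dec-false (m <? n)

≡ᵇ-true : m ≡ n → (m ≡ᵇ n) ≡ true
≡ᵇ-true {m} {n} = dec-true (m ≟ n)

≡ᵇ-false : m ≢ n → (m ≡ᵇ n) ≡ false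
≡ᵇ-false {m} {n} = dec-false (m ≟ n)

<ᵇ≡not-≤ᵇ : ∀ m n → (m <ᵇ n) ≡ not (n ≤ᵇ m)
<ᵇ≡not-≤ᵇ m n with n ≤? m
... | yes n≤m rewrite ≤ᵇ-true n≤m | <ᵇ-false (≤⇒≯ n≤m) = refl
... | no  n≰m rewrite ≤ᵇ-false n≰m | <ᵇ-true (≰⇒> n≰m) = refl

does⇒ : ∀ {p} {P : Set p} (P? : Dec P) → does P? ≡ true → P
does⇒ (yes p) _ = p

≢true⇒false : ∀ {p} → p ≢ true → p ≡ false
≢true⇒false = ¬-not

∧-true⁻¹ : ∀ {p q} → p ∧ q ≡ true → p ≡ true × q ≡ true
∧-true⁻¹ {true} q = refl , q

∧-true : ∀ {p q} → p ≡ true → q ≡ true → p ∧ q ≡ true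
∧-true refl q = q

not-∨ : ∀ p q → not (p ∨ q) ≡ not p ∧ not q
not-∨ true  q = refl
not-∨ false q = refl

indicator : Bool → ℕ
indicator b = if b then 1 else 0

punchIn : ℕ → ℕ → ℕ
punchIn a r = if r <ᵇ a then r else suc r

punchIn-< : r < a → punchIn a r ≡ r
punchIn-< r<a rewrite <ᵇ-true r<a = refl

punchIn-≥ : a ≤ r → punchIn a r ≡ suc r
punchIn-≥ a≤r rewrite <ᵇ-false (≤⇒≯ a≤r) = refl

1≤punchIn : ∀ a → 1 ≤ r → 1 ≤ punchIn a r
1≤punchIn {r} a 1≤r with r <ᵇ a
... | true  = 1≤r
... | false = s≤s z≤n

count-suc-true : ∀ f → f (suc n) ≡ true → count f (suc n) ≡ suc (count f n)
count-suc-true {n} f e rewrite e = +-comm (count f n) 1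

count-suc-false : ∀ f → f (suc n) ≡ false → count f (suc n) ≡ count f n
count-suc-false {n} f e rewrite e = +-identityʳ (count f n)

count-cong : ∀ n → (∀ {x} → 1 ≤ x → x ≤ n → f x ≡ g x) → count f n ≡ count g n
count-cong zero    f≗g = refl
count-cong (suc n) f≗g =
  cong₂ _+_ (count-cong n λ 1≤x x≤n → f≗g 1≤x (m≤n⇒m≤1+n x≤n))
            (cong indicator (f≗g (s≤s z≤n) ≤-refl))

count-false : ∀ n → (∀ {x} → 1 ≤ x → x ≤ n → f x ≡ false) → count f n ≡ 0
count-false {f} zero    f≡false = refl
count-false {f} (suc n) f≡false = trans (count-suc-false f (f≡false (s≤s z≤n) ≤-refl))
  (count-false n λ 1≤x x≤n → f≡false 1≤x (m≤n⇒m≤1+n x≤n))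

count-≤ : ∀ f n → count f n ≤ n
count-≤ f zero    = z≤n
count-≤ f (suc n) with f (suc n)
... | true  = subst (_≤ suc n) (+-comm 1 (count f n)) (s≤s (count-≤ f n))
... | false = subst (_≤ suc n) (sym (+-identityʳ (count f n))) (m≤n⇒m≤1+n (count-≤ f n))

count-mono : ∀ f → m ≤ n → count f m ≤ count f n
count-mono {m} {zero}  f z≤n = ≤-refl
count-mono {m} {suc n} f m≤1+n with m≤n⇒m<n∨m≡n m≤1+n
... | inj₂ refl      = ≤-refl
... | inj₁ (s≤s m≤n) = ≤-trans (count-mono f m≤n) (m≤m+n (count f n) _)

count-< : f n ≡ true → m < n → count f m < count f n
count-< {f} {suc n} {m} fn (s≤s m≤n) =
  subst (count f m <_) (sym (count-suc-true f fn)) (s≤s (count-mono f m≤n))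

count-<-⇔ : f m ≡ true → f n ≡ true → (count f m < count f n) ⇔ (m < n)
count-<-⇔ {f} fm fn = mk⇔
  (λ cm<cn → ≰⇒> λ n≤m → <⇒≱ cm<cn (count-mono f n≤m))
  (count-< fn)

count-injective : f m ≡ true → f n ≡ true → count f m ≡ count f n → m ≡ n
count-injective {f} {m} {n} fm fn cm≡cn with <-cmp m n
... | tri< m<n _ _ = contradiction cm≡cn (<⇒≢ (count-< fn m<n))
... | tri≈ _ m≡n _ = m≡n
... | tri> _ _ n<m = contradiction (sym cm≡cn) (<⇒≢ (count-< fm n<m))

count-attains : ∀ f n {j} → 1 ≤ j → j ≤ count f n →
                ∃[ a ] (1 ≤ a × a ≤ n × f a ≡ true × count f a ≡ j)
count-attains f zero    1≤j j≤0 = contradiction (≤-trans 1≤j j≤0) λ ()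
count-attains f (suc n) {j} 1≤j j≤ with j ≤? count f n
... | yes j≤′ with count-attains f n 1≤j j≤′
...   | a , 1≤a , a≤n , fa , ca = a , 1≤a , m≤n⇒m≤1+n a≤n , fa , ca
count-attains f (suc n) {j} 1≤j j≤ | no j≰ with f (suc n) in e
... | true  = suc n , s≤s z≤n , ≤-refl , e ,
              trans (count-suc-true f e) (≤-antisym (≰⇒> j≰) (subst (j ≤_) (+-comm _ 1) j≤))
... | false = contradiction (subst (j ≤_) (+-identityʳ _) j≤) j≰

count-≤ᵇ : ∀ f → a ≤ n → count (λ t → f t ∧ (t ≤ᵇ a)) n ≡ count f a
count-≤ᵇ {a} {zero} f z≤n = refl
count-≤ᵇ {a} {suc n} f a≤1+n with m≤n⇒m<n∨m≡n a≤1+n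
... | inj₁ (s≤s a≤n) =
  trans (count-suc-false (λ t → f t ∧ (t ≤ᵇ a))
           (trans (cong (f (suc n) ∧_) (≤ᵇ-false (<⇒≱ (s≤s a≤n)))) (∧-zeroʳ _)))
        (count-≤ᵇ f a≤n)
... | inj₂ refl = cong₂ _+_
  (count-cong n λ _ x≤n → trans (cong (f _ ∧_) (≤ᵇ-true (m≤n⇒m≤1+n x≤n))) (∧-identityʳ _))
  (cong indicator (trans (cong (f (suc n) ∧_) (≤ᵇ-true {suc n} ≤-refl)) (∧-identityʳ _)))

count-delete : ∀ f → 1 ≤ a → a ≤ n →
               count (λ x → not (x ≡ᵇ a) ∧ f x) n + indicator (f a) ≡ count f n
count-delete {n = zero} f (s≤s _) ()
count-delete {a} {suc n} f 1≤a a≤1+n with m≤n⇒m<n∨m≡n a≤1+n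
... | inj₂ refl = cong (_+ indicator (f (suc n))) (begin
  count f′ n + indicator (not (suc n ≡ᵇ suc n) ∧ f (suc n))
    ≡⟨ cong (λ e → count f′ n + indicator (not e ∧ f (suc n))) (≡ᵇ-true {suc n} refl) ⟩
  count f′ n + 0                                            ≡⟨ +-identityʳ _ ⟩
  count f′ n
    ≡⟨ count-cong n (λ {x} _ x≤n → cong (λ e → not e ∧ f x) (≡ᵇ-false (<⇒≢ (s≤s x≤n)))) ⟩
  count f n                                                 ∎)
  where
  open ≡-Reasoning
  f′ : ℕ → Bool
  f′ x = not (x ≡ᵇ suc n) ∧ f x
... | inj₁ (s≤s a≤n) = begin
  count f′ n + indicator (not (suc n ≡ᵇ a) ∧ f (suc n)) + indicator (f a)
    ≡⟨ cong (λ e → count f′ n + indicator (not e ∧ f (suc n)) + indicator (f a))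
            (≡ᵇ-false (≢-sym (<⇒≢ (s≤s a≤n)))) ⟩
  count f′ n + indicator (f (suc n)) + indicator (f a)  ≡⟨ xy∙z≈xz∙y (count f′ n) _ _ ⟩
  count f′ n + indicator (f a) + indicator (f (suc n))
    ≡⟨ cong (_+ indicator (f (suc n))) (count-delete f 1≤a a≤n) ⟩
  count f (suc n)                                       ∎
  where
  open ≡-Reasoning
  f′ : ℕ → Bool
  f′ x = not (x ≡ᵇ a) ∧ f x

count-punchIn-< : ∀ f → n < a → count (f ∘ punchIn a) n ≡ count f n
count-punchIn-< {n} f n<a = count-cong n λ _ x≤n → cong f (punchIn-< (≤-<-trans x≤n n<a))

count-punchIn : ∀ f → 1 ≤ a → a ≤ suc n →
                count (f ∘ punchIn a) n + indicator (f a) ≡ count f (suc n)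
count-punchIn {a} {zero} f (s≤s z≤n) (s≤s z≤n) = refl
count-punchIn {a} {suc n} f 1≤a a≤2+n with m≤n⇒m<n∨m≡n a≤2+n
... | inj₂ refl = cong (_+ indicator (f a)) (count-punchIn-< f ≤-refl)
... | inj₁ (s≤s a≤1+n) = begin
  count (f ∘ punchIn a) n + indicator (f (punchIn a (suc n))) + indicator (f a)
    ≡⟨ cong (λ k → count (f ∘ punchIn a) n + indicator (f k) + indicator (f a)) (punchIn-≥ a≤1+n) ⟩
  count (f ∘ punchIn a) n + indicator (f (suc (suc n))) + indicator (f a)
    ≡⟨ xy∙z≈xz∙y (count (f ∘ punchIn a) n) _ _ ⟩
  count (f ∘ punchIn a) n + indicator (f a) + indicator (f (suc (suc n)))
    ≡⟨ cong (_+ indicator (f (suc (suc n)))) (count-punchIn f 1≤a a≤1+n) ⟩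
  count f (suc (suc n))  ∎
  where open ≡-Reasoning

-- Down-closed predicates on the positive integers

DownClosed : (ℕ → Bool) → Set
DownClosed f = ∀ {x y} → f x ≡ true → 1 ≤ y → y ≤ x → f y ≡ true

BoundedBy : ℕ → (ℕ → Bool) → Set
BoundedBy N f = ∀ {x} → f x ≡ true → x ≤ N

DownClosed-∧ˡ : ∀ p → DownClosed f → DownClosed (λ x → p ∧ f x)
DownClosed-∧ˡ true  closed = closed
DownClosed-∧ˡ false closed ()

BoundedBy-∧ˡ : ∀ {N} p → BoundedBy N f → BoundedBy N (λ x → p ∧ f x)
BoundedBy-∧ˡ true  bounded = bounded
BoundedBy-∧ˡ false bounded ()

module _ {f : ℕ → Bool} (f-closed : DownClosed f) where

  count-all : ∀ n → f n ≡ true → count f n ≡ n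
  count-all zero    _  = refl
  count-all (suc zero) f1 rewrite f1 = refl
  count-all (suc (suc n)) fn = trans (count-suc-true f fn)
    (cong suc (count-all (suc n) (f-closed fn (s≤s z≤n) (n≤1+n _))))

  count<gap : 1 ≤ x → f x ≡ false → ∀ n → count f n < x
  count<gap 1≤x fx zero = 1≤x
  count<gap {x} 1≤x fx (suc n) with suc n <? x
  ... | yes 1+n<x = ≤-<-trans (count-≤ f (suc n)) 1+n<x
  ... | no  1+n≮x = subst (_< x) (sym (count-suc-false f f[1+n]≡false)) (count<gap 1≤x fx n)
    where
    f[1+n]≡false : f (suc n) ≡ false
    f[1+n]≡false = ≢true⇒false λ f[1+n] →
      contradiction (trans (sym fx) (f-closed f[1+n] 1≤x (≮⇒≥ 1+n≮x))) λ ()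

  downClosed-initial : ∀ {N} → BoundedBy N f → 1 ≤ x → f x ≡ (x ≤ᵇ count f N)
  downClosed-initial {x} {N} bounded 1≤x with f x in fx
  ... | true  =
    sym (≤ᵇ-true (subst (_≤ count f N) (count-all x fx) (count-mono f (bounded fx))))
  ... | false = sym (≤ᵇ-false (<⇒≱ (count<gap 1≤x fx N)))

punchIn-≤-⇔ : a ≤ suc n → (punchIn a r ≤ suc n) ⇔ (r ≤ n)
punchIn-≤-⇔ {a} {n} {r} a≤1+n with r <? a
... | yes r<a rewrite punchIn-< r<a = mk⇔ (λ _ → ≤-pred (<-≤-trans r<a a≤1+n)) m≤n⇒m≤1+n
... | no  r≮a rewrite punchIn-≥ (≮⇒≥ r≮a) = mk⇔ ≤-pred s≤s

punchIn-≤-⇔′ : n < a → (punchIn a r ≤ n) ⇔ (r ≤ n)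
punchIn-≤-⇔′ {n} {a} {r} n<a with r <? a
... | yes r<a rewrite punchIn-< r<a = mk⇔ id id
... | no  r≮a rewrite punchIn-≥ (≮⇒≥ r≮a) =
  mk⇔ (λ 1+r≤n → contradiction (≤-trans (n≤1+n r) 1+r≤n) r≰n) (λ r≤n → contradiction r≤n r≰n)
  where
  r≰n : r ≰ n
  r≰n = <⇒≱ (<-≤-trans n<a (≮⇒≥ r≮a))

punchIn-≤ᵇ : ∀ {c h} → c + indicator (a ≤ᵇ h) ≡ h → (punchIn a r ≤ᵇ h) ≡ (r ≤ᵇ c)
punchIn-≤ᵇ {a} {r} {c} {h} c+[a≤h]≡h with a ≤? h
... | yes a≤h = subst (λ h → (punchIn a r ≤ᵇ h) ≡ (r ≤ᵇ c)) 1+c≡h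
  (does-⇔ (punchIn-≤-⇔ (subst (a ≤_) (sym 1+c≡h) a≤h)) (punchIn a r ≤? suc c) (r ≤? c))
  where
  1+c≡h : suc c ≡ h
  1+c≡h = trans (+-comm 1 c) (subst (λ e → c + indicator e ≡ h) (≤ᵇ-true a≤h) c+[a≤h]≡h)
... | no  a≰h = subst (λ h → (punchIn a r ≤ᵇ h) ≡ (r ≤ᵇ c)) c≡h
  (does-⇔ (punchIn-≤-⇔′ (subst (_< a) (sym c≡h) (≰⇒> a≰h))) (punchIn a r ≤? c) (r ≤? c))
  where
  c≡h : c ≡ h
  c≡h = trans (sym (+-identityʳ c)) (subst (λ e → c + indicator e ≡ h) (≤ᵇ-false a≰h) c+[a≤h]≡h)

≤ᵇ-count-delete : ∀ {N} → DownClosed f → BoundedBy N f → 1 ≤ a → a ≤ N → 1 ≤ r →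
                  (r ≤ᵇ count (λ x → not (x ≡ᵇ a) ∧ f x) N) ≡ f (punchIn a r)
≤ᵇ-count-delete {f} {a} {r} {N} closed bounded 1≤a a≤N 1≤r = begin
  r ≤ᵇ count f′ N           ≡⟨ sym (punchIn-≤ᵇ {a} {r} c+[a≤h]≡h) ⟩
  punchIn a r ≤ᵇ count f N  ≡⟨ sym (downClosed-initial closed bounded (1≤punchIn a 1≤r)) ⟩
  f (punchIn a r)           ∎
  where
  open ≡-Reasoning
  f′ : ℕ → Bool
  f′ x = not (x ≡ᵇ a) ∧ f x
  c+[a≤h]≡h : count f′ N + indicator (a ≤ᵇ count f N) ≡ count f N
  c+[a≤h]≡h = subst (λ e → count f′ N + indicator e ≡ count f N)
                    (downClosed-initial closed bounded 1≤a) (count-delete f 1≤a a≤N)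

anyUpTo-false : ∀ g n → (∀ {k} → 1 ≤ k → k ≤ n → g k ≡ false) → anyUpTo g n ≡ false
anyUpTo-false g zero    _     = refl
anyUpTo-false g (suc n) g≡false rewrite g≡false (s≤s z≤n) (≤-refl {suc n}) =
  trans (∨-identityʳ _) (anyUpTo-false g n λ 1≤k k≤n → g≡false 1≤k (m≤n⇒m≤1+n k≤n))

anyUpTo-unique : ∀ g n → 1 ≤ a → a ≤ n → (∀ {k} → 1 ≤ k → k ≤ n → k ≢ a → g k ≡ false) →
                 anyUpTo g n ≡ g a
anyUpTo-unique g zero (s≤s _) ()
anyUpTo-unique {a} g (suc n) 1≤a a≤1+n others with m≤n⇒m<n∨m≡n a≤1+n
... | inj₁ (s≤s a≤n) rewrite others (s≤s z≤n) ≤-refl (≢-sym (<⇒≢ (s≤s a≤n))) =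
  trans (∨-identityʳ _) (anyUpTo-unique g n 1≤a a≤n λ 1≤k k≤n → others 1≤k (m≤n⇒m≤1+n k≤n))
... | inj₂ refl
  rewrite anyUpTo-false g n λ 1≤k k≤n → others 1≤k (m≤n⇒m≤1+n k≤n) (<⇒≢ (s≤s k≤n)) = refl

inATK-within : ∀ {a b x y} → 1 ≤ x → 1 ≤ y → x + y ≤ a + b →
               inATK a b x y ≡ (x ≡ᵇ a) ∨ (y ≡ᵇ b)
inATK-within {a} {b} {x@(suc _)} {y@(suc _)} _ _ x+y≤a+b with x ≟ a | y ≟ b
... | yes x≡a | _
  rewrite ≡ᵇ-true x≡a
        | ≤ᵇ-true (+-cancelˡ-≤ a y b (subst (λ x → x + y ≤ a + b) x≡a x+y≤a+b)) = ∨-zeroʳ _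
... | no x≢a | yes y≡b
  rewrite ≡ᵇ-false x≢a | ≡ᵇ-true y≡b
        | ≤ᵇ-true (+-cancelʳ-≤ b x a (subst (λ y → x + y ≤ a + b) y≡b x+y≤a+b)) = refl
... | no x≢a | no y≢b rewrite ≡ᵇ-false x≢a | ≡ᵇ-false y≢b = refl

-- The reduction Π(F, i, j)

keptCount : ℕ → ℕ → ℕ → ℕ → ℕ
keptCount i j v n = if n <ᵇ i then v else if n ≡ᵇ i then j else 0

module Reduction (F : Ferrers) {i j a : ℕ} (1≤a : 1 ≤ a) (a≤i : a ≤ i)
                 (a∈Δᵢ : onDiag (mem F) i a ≡ true) (rank≡j : rank (mem F) i a ≡ j) where

  private
    S = mem F
    N = bound F
    b = suc i ∸ a
    variable
      d s t : ℕ

  a+b≡1+i : a + b ≡ suc i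
  a+b≡1+i = m+[n∸m]≡n (m≤n⇒m≤1+n a≤i)

  1≤b : 1 ≤ b
  1≤b = subst (1 ≤_) (sym (+-∸-assoc 1 a≤i)) (s≤s z≤n)

  a≤N : a ≤ N
  a≤N = proj₁ (finite F a b a∈Δᵢ)

  b≤N : b ≤ N
  b≤N = proj₂ (finite F a b a∈Δᵢ)

  -- kept d x: (d , x) ≤ (i , a) lexicographically.  For a cell of F on Δᵢ this says
  -- rank ≤ j, as rank is strictly increasing along Δᵢ ∩ F.
  kept : ℕ → ℕ → Bool
  kept d x = (d <ᵇ i) ∨ ((d ≡ᵇ i) ∧ (x ≤ᵇ a))

  kept⇒ : kept d x ≡ true → d < i ⊎ (d ≡ i × x ≤ a)
  kept⇒ {d} {x} k with d <ᵇ i in d<i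
  ... | true  = inj₁ (does⇒ (d <? i) d<i)
  ... | false = let d≡i , x≤a = ∧-true⁻¹ k in inj₂ (does⇒ (d ≟ i) d≡i , does⇒ (x ≤? a) x≤a)

  kept⇐ : ∀ x → d < i ⊎ (d ≡ i × x ≤ a) → kept d x ≡ true
  kept⇐ x (inj₁ d<i) rewrite <ᵇ-true d<i = refl
  kept⇐ x (inj₂ (refl , x≤a))
    rewrite <ᵇ-false (<-irrefl {i} refl) | ≡ᵇ-true {i} refl | ≤ᵇ-true x≤a = refl

  kept⇒≤ : kept d x ≡ true → d ≤ i
  kept⇒≤ {x = x} k with kept⇒ {x = x} k
  ... | inj₁ d<i       = <⇒≤ d<i
  ... | inj₂ (d≡i , _) = ≤-reflexive d≡i

  kept-mono : ∀ {d′ x′} → d′ ≤ d → x′ ≤ x → kept d x ≡ true → kept d′ x′ ≡ true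
  kept-mono {x = x} {x′ = x′} d′≤d x′≤x k with kept⇒ {x = x} k
  ... | inj₁ d<i = kept⇐ x′ (inj₁ (≤-<-trans d′≤d d<i))
  ... | inj₂ (refl , x≤a) with m≤n⇒m<n∨m≡n d′≤d
  ...   | inj₁ d′<i = kept⇐ x′ (inj₁ d′<i)
  ...   | inj₂ d′≡i = kept⇐ x′ (inj₂ (d′≡i , ≤-trans x′≤x x≤a))

  kept-at-i : ∀ x → kept i x ≡ (x ≤ᵇ a)
  kept-at-i x rewrite <ᵇ-false (<-irrefl {i} refl) | ≡ᵇ-true {i} refl = refl

  truncated : Cells
  truncated x y = S x y ∧ kept (x + y ∸ 1) x

  truncated-closed : truncated x y ≡ true → 1 ≤ s → s ≤ x → 1 ≤ t → t ≤ y →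
                     truncated s t ≡ true
  truncated-closed {x} {y} {s} {t} xy∈ 1≤s s≤x 1≤t t≤y =
    let xy∈S , xy-kept = ∧-true⁻¹ xy∈ in
    ∧-true (downClosed F x y s t xy∈S 1≤s s≤x 1≤t t≤y)
           (kept-mono {x = x} (∸-monoˡ-≤ 1 (+-mono-≤ s≤x t≤y)) s≤x xy-kept)

  truncated-bounded : truncated x y ≡ true → x ≤ N × y ≤ N
  truncated-bounded {x} {y} xy∈ = finite F x y (proj₁ (∧-true⁻¹ xy∈))

  truncated-rect : 1 ≤ x → x ≤ a → 1 ≤ y → y ≤ b → truncated x y ≡ true
  truncated-rect = truncated-closed (∧-true a∈Δᵢ (kept⇐ a (inj₂ (cong (_∸ 1) a+b≡1+i , ≤-refl))))

  truncated-beyond : i < x + y ∸ 1 → truncated x y ≡ false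
  truncated-beyond {x} i<d = ≢true⇒false λ xy∈ → <⇒≱ i<d (kept⇒≤ {x = x} (proj₂ (∧-true⁻¹ xy∈)))

  onDiag-index : ∀ n → t ≤ suc n → t + (suc n ∸ t) ∸ 1 ≡ n
  onDiag-index n t≤1+n = cong (_∸ 1) (m+[n∸m]≡n t≤1+n)

  onDiag-truncated : ∀ n → t ≤ suc n → onDiag truncated n t ≡ onDiag S n t ∧ kept n t
  onDiag-truncated {t} n t≤1+n = cong (λ d → onDiag S n t ∧ kept d t) (onDiag-index n t≤1+n)

  diagCount-truncated : ∀ n → diagCount truncated n ≡ keptCount i j (diagCount S n) n
  diagCount-truncated n with <-cmp n i
  ... | tri< n<i _ _ rewrite <ᵇ-true n<i = count-cong n λ {t} _ t≤n → begin
    onDiag truncated n t        ≡⟨ onDiag-truncated n (m≤n⇒m≤1+n t≤n) ⟩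
    onDiag S n t ∧ kept n t     ≡⟨ cong (onDiag S n t ∧_) (kept⇐ t (inj₁ n<i)) ⟩
    onDiag S n t ∧ true         ≡⟨ ∧-identityʳ _ ⟩
    onDiag S n t                ∎
    where open ≡-Reasoning
  ... | tri≈ _ refl _ rewrite <ᵇ-false (<-irrefl {i} refl) | ≡ᵇ-true {i} refl = begin
    diagCount truncated i                      ≡⟨ count-cong i (λ {t} _ t≤i →
      trans (onDiag-truncated i (m≤n⇒m≤1+n t≤i)) (cong (onDiag S i t ∧_) (kept-at-i t))) ⟩
    count (λ t → onDiag S i t ∧ (t ≤ᵇ a)) i    ≡⟨ count-≤ᵇ (onDiag S i) a≤i ⟩
    rank S i a                                 ≡⟨ rank≡j ⟩
    j                                          ∎
    where open ≡-Reasoning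
  ... | tri> _ _ i<n rewrite <ᵇ-false (<⇒≯ i<n) | ≡ᵇ-false (≢-sym (<⇒≢ i<n)) =
    count-false n λ {t} _ t≤n →
      truncated-beyond (subst (i <_) (sym (onDiag-index n (m≤n⇒m≤1+n t≤n))) i<n)

  j<ᵇrank≡not-x≤ᵇa : onDiag S i x ≡ true → (j <ᵇ rank S i x) ≡ not (x ≤ᵇ a)
  j<ᵇrank≡not-x≤ᵇa {x} x∈Δᵢ = begin
    j <ᵇ rank S i x             ≡⟨ cong (_<ᵇ rank S i x) (sym rank≡j) ⟩
    rank S i a <ᵇ rank S i x    ≡⟨ does-⇔ (count-<-⇔ a∈Δᵢ x∈Δᵢ) (_ <? _) (a <? x) ⟩
    a <ᵇ x                      ≡⟨ <ᵇ≡not-≤ᵇ a x ⟩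
    not (x ≤ᵇ a)                ∎
    where open ≡-Reasoning

  isLexLater≡not-kept : S x y ≡ true → isLexLater S i j x y ≡ not (kept (x + y ∸ 1) x)
  isLexLater≡not-kept {x} {y} xy∈ with positive F x y xy∈
  isLexLater≡not-kept {suc x} {suc y} xy∈ | s≤s _ , s≤s _ rewrite xy∈ with <-cmp (x + suc y) i
  ... | tri< d<i d≢i _
    rewrite <ᵇ-false (<⇒≯ d<i) | ≡ᵇ-false d≢i | <ᵇ-true d<i = refl
  ... | tri> _ d≢i i<d
    rewrite <ᵇ-true i<d | ≡ᵇ-false d≢i | <ᵇ-false (<⇒≯ i<d) = refl
  ... | tri≈ _ d≡i _
    rewrite ≡ᵇ-true d≡i | <ᵇ-false (<-irrefl d≡i) | <ᵇ-false (<-irrefl (sym d≡i)) =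
    j<ᵇrank≡not-x≤ᵇa (subst (λ y → S (suc x) y ≡ true) (sym i∸x≡1+y) xy∈)
    where
    i∸x≡1+y : i ∸ x ≡ suc y
    i∸x≡1+y = trans (cong (_∸ x) (sym d≡i)) (m+n∸m≡n x (suc y))

  inATKjth≡inATK : ∀ x y → inATKjth S i j x y ≡ inATK a b x y
  inATKjth≡inATK x y = trans (anyUpTo-unique jth i 1≤a a≤i other≡false) jth[a]≡atk
    where
    jth : ℕ → Bool
    jth k = onDiag S i k ∧ (rank S i k ≡ᵇ j) ∧ inATK k (suc i ∸ k) x y
    jth[a]≡atk : jth a ≡ inATK a b x y
    jth[a]≡atk rewrite a∈Δᵢ | rank≡j | ≡ᵇ-true {j} refl = refl
    other≡false : ∀ {k} → 1 ≤ k → k ≤ i → k ≢ a → jth k ≡ false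
    other≡false {k} _ _ k≢a with onDiag S i k in k∈Δᵢ
    ... | false = refl
    ... | true rewrite ≡ᵇ-false {rank S i k} {j}
                  (λ r≡j → k≢a (count-injective k∈Δᵢ a∈Δᵢ (trans r≡j (sym rank≡j)))) = refl

  not-inATK∨not-kept : 1 ≤ x → 1 ≤ y →
    not (inATK a b x y ∨ not (kept (x + y ∸ 1) x)) ≡
    not (x ≡ᵇ a) ∧ (not (y ≡ᵇ b) ∧ kept (x + y ∸ 1) x)
  not-inATK∨not-kept {x@(suc x′)} {y} 1≤x 1≤y with kept (x + y ∸ 1) x in xy-kept
  ... | false =
    trans (cong not (∨-zeroʳ _)) (sym (trans (cong (not (x ≡ᵇ a) ∧_) (∧-zeroʳ _)) (∧-zeroʳ _)))
  ... | true  = begin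
    not (inATK a b x y ∨ false)      ≡⟨ cong not (∨-identityʳ _) ⟩
    not (inATK a b x y)              ≡⟨ cong not (inATK-within 1≤x 1≤y x+y≤a+b) ⟩
    not ((x ≡ᵇ a) ∨ (y ≡ᵇ b))        ≡⟨ not-∨ (x ≡ᵇ a) (y ≡ᵇ b) ⟩
    not (x ≡ᵇ a) ∧ not (y ≡ᵇ b)      ≡⟨ cong (not (x ≡ᵇ a) ∧_) (∧-identityʳ _) ⟨
    not (x ≡ᵇ a) ∧ (not (y ≡ᵇ b) ∧ true) ∎
    where
    open ≡-Reasoning
    x+y≤a+b : x + y ≤ a + b
    x+y≤a+b = subst (x + y ≤_) (sym a+b≡1+i) (s≤s (kept⇒≤ {x = x} xy-kept))

  remaining-∈ : S x y ≡ true →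
                remaining S i j x y ≡ not (x ≡ᵇ a) ∧ (not (y ≡ᵇ b) ∧ truncated x y)
  remaining-∈ {x} {y} xy∈ = let 1≤x , 1≤y = positive F x y xy∈ in begin
    S x y ∧ not (inATKjth S i j x y ∨ isLexLater S i j x y)
      ≡⟨ cong (_∧ not (inATKjth S i j x y ∨ isLexLater S i j x y)) xy∈ ⟩
    not (inATKjth S i j x y ∨ isLexLater S i j x y)
      ≡⟨ cong₂ (λ p q → not (p ∨ q)) (inATKjth≡inATK x y) (isLexLater≡not-kept xy∈) ⟩
    not (inATK a b x y ∨ not (kept (x + y ∸ 1) x))
      ≡⟨ not-inATK∨not-kept 1≤x 1≤y ⟩
    not (x ≡ᵇ a) ∧ (not (y ≡ᵇ b) ∧ kept (x + y ∸ 1) x)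
      ≡⟨ cong (λ v → not (x ≡ᵇ a) ∧ (not (y ≡ᵇ b) ∧ (v ∧ kept (x + y ∸ 1) x))) xy∈ ⟨
    not (x ≡ᵇ a) ∧ (not (y ≡ᵇ b) ∧ truncated x y) ∎
    where open ≡-Reasoning

  remaining-∉ : S x y ≡ false →
                remaining S i j x y ≡ not (x ≡ᵇ a) ∧ (not (y ≡ᵇ b) ∧ truncated x y)
  remaining-∉ {x} {y} xy∉ rewrite xy∉ =
    sym (trans (cong (not (x ≡ᵇ a) ∧_) (∧-zeroʳ _)) (∧-zeroʳ _))

  remaining≡ : ∀ x y → remaining S i j x y ≡ not (x ≡ᵇ a) ∧ (not (y ≡ᵇ b) ∧ truncated x y)
  remaining≡ x y = [ remaining-∈ , remaining-∉ ]′ (true⊎false (S x y))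

  alignTop-remaining : ∀ r c → alignTop N (remaining S i j) (suc r) (suc c) ≡
                               not (suc c ≡ᵇ b) ∧ truncated (punchIn a (suc r)) (suc c)
  alignTop-remaining r c = begin
    suc r ≤ᵇ count (λ x → remaining S i j x (suc c)) N
      ≡⟨ cong (suc r ≤ᵇ_) (count-cong N λ {x} _ _ → remaining≡ x (suc c)) ⟩
    suc r ≤ᵇ count (λ x → not (x ≡ᵇ a) ∧ column x) N
      ≡⟨ ≤ᵇ-count-delete (DownClosed-∧ˡ (not (suc c ≡ᵇ b)) column-closed)
                         (BoundedBy-∧ˡ (not (suc c ≡ᵇ b)) column-bounded)
                         1≤a a≤N (s≤s z≤n) ⟩
    column (punchIn a (suc r)) ∎
    where
    open ≡-Reasoning
    column : ℕ → Bool
    column x = not (suc c ≡ᵇ b) ∧ truncated x (suc c)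
    column-closed : DownClosed (λ x → truncated x (suc c))
    column-closed x∈ 1≤y y≤x = truncated-closed x∈ 1≤y y≤x (s≤s z≤n) ≤-refl
    column-bounded : BoundedBy N (λ x → truncated x (suc c))
    column-bounded x∈ = proj₁ (truncated-bounded x∈)

  Π≡truncated∘punchIn : ∀ r c →
    Π F i j (suc r) (suc c) ≡ truncated (punchIn a (suc r)) (punchIn b (suc c))
  Π≡truncated∘punchIn r c = begin
    suc c ≤ᵇ count (alignTop N (remaining S i j) (suc r)) N
      ≡⟨ cong (suc c ≤ᵇ_) (count-cong N λ { {suc y} _ _ → alignTop-remaining r y }) ⟩
    suc c ≤ᵇ count (λ y → not (y ≡ᵇ b) ∧ row y) N
      ≡⟨ ≤ᵇ-count-delete row-closed row-bounded 1≤b b≤N (s≤s z≤n) ⟩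
    row (punchIn b (suc c)) ∎
    where
    open ≡-Reasoning
    row : ℕ → Bool
    row = truncated (punchIn a (suc r))
    row-closed : DownClosed row
    row-closed y∈ 1≤t t≤y = truncated-closed y∈ (1≤punchIn a (s≤s z≤n)) ≤-refl 1≤t t≤y
    row-bounded : BoundedBy N row
    row-bounded y∈ = proj₂ (truncated-bounded y∈)

  Π-on-diagonal : ∀ {M s c} → 1 ≤ s → 1 ≤ c → s + c ≡ suc M →
                  Π F i j s c ≡ onDiag truncated (suc M) (punchIn a s)
  Π-on-diagonal {M} {s@(suc r)} {c@(suc c′)} _ _ s+c≡1+M =
    trans (Π≡truncated∘punchIn r c′) cases
    where
    1+M∸s≡c : suc M ∸ s ≡ c
    1+M∸s≡c = trans (cong (_∸ s) (sym s+c≡1+M)) (m+n∸m≡n s c)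
    2+M∸s≡1+c : suc (suc M) ∸ s ≡ suc c
    2+M∸s≡1+c = trans (+-∸-assoc 1 (subst (s ≤_) s+c≡1+M (m≤m+n s c))) (cong suc 1+M∸s≡c)
    cases : truncated (punchIn a s) (punchIn b c) ≡
            truncated (punchIn a s) (suc (suc M) ∸ punchIn a s)
    cases with s <? a | c <? b
    ... | yes s<a | yes c<b rewrite punchIn-< s<a | punchIn-< c<b | 2+M∸s≡1+c =
      trans (truncated-rect (s≤s z≤n) (<⇒≤ s<a) (s≤s z≤n) (<⇒≤ c<b))
            (sym (truncated-rect (s≤s z≤n) (<⇒≤ s<a) (s≤s z≤n) c<b))
    ... | yes s<a | no c≮b rewrite punchIn-< s<a | punchIn-≥ (≮⇒≥ c≮b) | 2+M∸s≡1+c = refl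
    ... | no s≮a | yes c<b rewrite punchIn-≥ (≮⇒≥ s≮a) | punchIn-< c<b | 1+M∸s≡c = refl
    ... | no s≮a | no c≮b rewrite punchIn-≥ (≮⇒≥ s≮a) | punchIn-≥ (≮⇒≥ c≮b) | 1+M∸s≡c =
      trans (truncated-beyond (<-≤-trans i<s+c (+-monoʳ-≤ s (n≤1+n c))))
            (sym (truncated-beyond i<s+c))
      where
      i<s+c : i < s + c
      i<s+c = subst (_≤ s + c) a+b≡1+i (+-mono-≤ (≮⇒≥ s≮a) (≮⇒≥ c≮b))

  diagCount-Π≡count-punchIn : ∀ M →
    diagCount (Π F i j) M ≡ count (onDiag truncated (suc M) ∘ punchIn a) M
  diagCount-Π≡count-punchIn M = count-cong M λ {s} 1≤s s≤M →
    Π-on-diagonal 1≤s (subst (1 ≤_) (sym (+-∸-assoc 1 s≤M)) (s≤s z≤n))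
                  (m+[n∸m]≡n (m≤n⇒m≤1+n s≤M))

  count-punchIn-diagonal : ∀ M → count (onDiag truncated (suc M) ∘ punchIn a) M ≡
                                 diagCount truncated (suc M) ∸ 1
  count-punchIn-diagonal M with a ≤? suc M
  ... | no a≰1+M = begin
    count (δ ∘ punchIn a) M  ≡⟨ count-punchIn-< δ (≤-<-trans (n≤1+n M) (≰⇒> a≰1+M)) ⟩
    count δ M                ≡⟨ cong (_∸ 1) (count-suc-true δ δ[1+M]) ⟨
    count δ (suc M) ∸ 1      ∎
    where
    open ≡-Reasoning
    δ : ℕ → Bool
    δ = onDiag truncated (suc M)
    δ[1+M] : δ (suc M) ≡ true
    δ[1+M] = subst (λ y → truncated (suc M) y ≡ true) (sym (m+n∸n≡m 1 M))
                   (truncated-rect (s≤s z≤n) (<⇒≤ (≰⇒> a≰1+M)) (s≤s z≤n) 1≤b)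
  ... | yes a≤1+M with suc M ≤? i
  ...   | yes 1+M≤i = begin
    count (δ ∘ punchIn a) M
      ≡⟨ m+n∸n≡m _ 1 ⟨
    count (δ ∘ punchIn a) M + 1 ∸ 1
      ≡⟨ cong (λ v → count (δ ∘ punchIn a) M + indicator v ∸ 1) δ[a] ⟨
    count (δ ∘ punchIn a) M + indicator (δ a) ∸ 1
      ≡⟨ cong (_∸ 1) (count-punchIn δ 1≤a a≤1+M) ⟩
    count δ (suc M) ∸ 1
      ∎
    where
    open ≡-Reasoning
    δ : ℕ → Bool
    δ = onDiag truncated (suc M)
    δ[a] : δ a ≡ true
    δ[a] = truncated-rect 1≤a ≤-refl (subst (1 ≤_) (sym (+-∸-assoc 1 a≤1+M)) (s≤s z≤n))
                          (∸-monoˡ-≤ a (s≤s 1+M≤i))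
  ...   | no 1+M≰i = trans (m+n≡0⇒m≡0 _ (trans (count-punchIn δ 1≤a a≤1+M) count-δ≡0))
                           (cong (_∸ 1) (sym count-δ≡0))
    where
    δ : ℕ → Bool
    δ = onDiag truncated (suc M)
    count-δ≡0 : count δ (suc M) ≡ 0
    count-δ≡0 = count-false (suc M) λ {t} _ t≤1+M →
      truncated-beyond
        (subst (i <_) (sym (onDiag-index (suc M) (m≤n⇒m≤1+n t≤1+M))) (≰⇒> 1+M≰i))

  diagCount-Π : ∀ M → diagCount (Π F i j) M ≡ keptCount i j (diagCount S (suc M)) (suc M) ∸ 1
  diagCount-Π M = begin
    diagCount (Π F i j) M                            ≡⟨ diagCount-Π≡count-punchIn M ⟩
    count (onDiag truncated (suc M) ∘ punchIn a) M   ≡⟨ count-punchIn-diagonal M ⟩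
    diagCount truncated (suc M) ∸ 1                  ≡⟨ cong (_∸ 1) (diagCount-truncated (suc M)) ⟩
    keptCount i j (diagCount S (suc M)) (suc M) ∸ 1  ∎
    where open ≡-Reasoning

diagCount-Π : ∀ F i j → 1 ≤ j → j ≤ diagCount (mem F) i → ∀ M →
              diagCount (Π F i j) M ≡ keptCount i j (diagCount (mem F) (suc M)) (suc M) ∸ 1
diagCount-Π F i j 1≤j j≤|Δᵢ| with count-attains (onDiag (mem F) i) i 1≤j j≤|Δᵢ|
... | a , 1≤a , a≤i , a∈Δᵢ , rank≡j = Reduction.diagCount-Π F 1≤a a≤i a∈Δᵢ rank≡j

lemma2p12 : (F F′ : Ferrers) → DiagEquiv (mem F) (mem F′) →
            (i j : ℕ) → 1 ≤ i → 1 ≤ j → j ≤ diagCount (mem F) i →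
            DiagEquiv (Π F i j) (Π F′ i j)
lemma2p12 F F′ F≈F′ i j _ 1≤j j≤|Δᵢ| M = begin
  diagCount (Π F i j) M
    ≡⟨ diagCount-Π F i j 1≤j j≤|Δᵢ| M ⟩
  keptCount i j (diagCount (mem F) (suc M)) (suc M) ∸ 1
    ≡⟨ cong (λ v → keptCount i j v (suc M) ∸ 1) (F≈F′ (suc M)) ⟩
  keptCount i j (diagCount (mem F′) (suc M)) (suc M) ∸ 1
    ≡⟨ diagCount-Π F′ i j 1≤j (subst (j ≤_) (F≈F′ i) j≤|Δᵢ|) M ⟨
  diagCount (Π F′ i j) M
    ∎
  where open ≡-Reasoning
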